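{- For all integers $m,n\geq 2$, the complete bipartite graph $K_{m,n}$ satisfies $\operatorname{car}(K_{m,n})=3$.
   Context: All graphs are finite, simple and undirected; $G[X]$ denotes the subgraph induced by $X$. A set $S\subseteq V(G)$ is cycle convex if for every $u\in V(G)\setminus S$ the graph $G[S\cup\{u\}]$ contains no cycle passing through $u$. The cycle convex hull $\langle S\rangle$ is the smallest cycle convex set containing $S$. A set $S$ is Carathéodory independent if there is $p\in\langle S\rangle$ with $p\notin \bigcup_{a\in S}\langle S\setminus\{a\}\rangle$. The Carathéodory number $\operatorname{car}(G)$ is the maximum cardinality of a Carathéodory independent set of $G$. -}

module Defs where

open import Level using (0ℓ)
open import Data.Nat using (ℕ; _+_; _<_; _≤_)
open import Data.Fin using (Fin; toℕ)
open import Data.Fin.Subset using (Subset; _∈_; _∉_; _⊆_; ⁅_⁆; _─_; ∣_∣)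
open import Data.List using (List; []; _∷_; _++_; [_]; length)
open import Data.List.Relation.Unary.All using (All)
open import Data.List.Relation.Unary.Linked using (Linked)
open import Data.List.Relation.Unary.Unique.Propositional using (Unique)
open import Data.Product using (Σ; _×_)
open import Data.Sum using (_⊎_)
open import Relation.Nullary using (¬_)
open import Relation.Binary.PropositionalEquality using (_≡_)

record Graph : Set₁ where
  field
    n        : ℕ
    Adj      : Fin n → Fin n → Set
    Adj-sym  : ∀ {x y} → Adj x y → Adj y x
    Adj-irr  : ∀ {x} → ¬ Adj x x

open Graph public

module _ (G : Graph) where

  -- A cycle of G[S ∪ {u}] passing through u:  u, v₁, …, v_k (k ≥ 2) pairwise
  -- distinct, the v_i in S, consecutive vertices adjacent, v_k adjacent to u.
  CycleThrough : Subset (n G) → Fin (n G) → Set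
  CycleThrough S u =
    Σ (List (Fin (n G))) λ rest →
      (2 ≤ length rest) × All (_∈ S) rest × Unique (u ∷ rest)
        × Linked (Adj G) (u ∷ rest ++ [ u ])

  CycleConvex : Subset (n G) → Set
  CycleConvex S = ∀ u → u ∉ S → ¬ CycleThrough S u

  InHull : Subset (n G) → Fin (n G) → Set
  InHull S p = ∀ T → S ⊆ T → CycleConvex T → p ∈ T

  CaratheodoryIndependent : Subset (n G) → Set
  CaratheodoryIndependent S =
    Σ (Fin (n G)) λ p → InHull S p × (∀ a → a ∈ S → ¬ InHull (S ─ ⁅ a ⁆) p)

  CaratheodoryNumber : ℕ → Set
  CaratheodoryNumber k =
    (Σ (Subset (n G)) λ S → CaratheodoryIndependent S × ∣ S ∣ ≡ k)
    × (∀ S → CaratheodoryIndependent S → ∣ S ∣ ≤ k)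

-- Complete bipartite graph K_{a,b} on Fin (a + b): parts {i | i < a} and {i | a ≤ i}.
KAdj : (a b : ℕ) → Fin (a + b) → Fin (a + b) → Set
KAdj a b i j = (toℕ i < a × a ≤ toℕ j) ⊎ (a ≤ toℕ i × toℕ j < a)

private
  open import Data.Product using (_,_)
  open import Data.Sum using (inj₁; inj₂)
  open import Data.Nat.Properties using (<⇒≱)

  KAdj-sym : ∀ a b {i j} → KAdj a b i j → KAdj a b j i
  KAdj-sym a b (inj₁ (p , q)) = inj₂ (q , p)
  KAdj-sym a b (inj₂ (p , q)) = inj₁ (q , p)

  KAdj-irr : ∀ a b {i} → ¬ KAdj a b i i
  KAdj-irr a b (inj₁ (p , q)) = <⇒≱ p q
  KAdj-irr a b (inj₂ (p , q)) = <⇒≱ q p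

K : ℕ → ℕ → Graph
K a b = record { n = a + b ; Adj = KAdj a b ; Adj-sym = KAdj-sym a b ; Adj-irr = KAdj-irr a b }

-- In a triangle-free graph a cycle through u ∉ S in G[S ∪ {u}] has length at least 4, so it
-- contains a path x – z – y of vertices of S (a cherry); hence a set without a cherry is cycle
-- convex and is its own hull. A cycle convex set T containing a cherry contains every common
-- neighbour of its ends. In K_{m,n} (m, n ≥ 2) these are the whole side of the centre z, and two
-- of them together with the neighbour x of z then pull in the other side: the hull of a set
-- with a cherry is everything. So a Carathéodory independent S contains a cherry, and if
-- ∣S∣ ≥ 4 a further vertex of S is adjacent to z or to x, giving a cherry that avoids the end y;
-- then the hull of S − y is everything, contradicting independence. A cherry with any fourth
-- vertex as p attains 3. Only three properties of K_{m,n} are used: it is triangle-free, every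
-- vertex is adjacent to an end of every edge, and every vertex has two neighbours.
module Submission where

open import Defs
open import Data.Nat using (ℕ; suc; _≤_; _<_; z≤n; s≤s; _<?_)
open import Data.Nat.Properties
  using (≤-refl; ≤-reflexive; ≤-trans; ≤-antisym; ≤-pred; <-≤-trans; <⇒≱; ≮⇒≥; ≰⇒>; _≤?_; n≤1+n; m≤m+n)
open import Data.Fin using (Fin; toℕ; _↑ˡ_; _↑ʳ_; _≟_) renaming (zero to fzero; suc to fsuc)
open import Data.Fin.Properties using (toℕ-↑ˡ; toℕ-↑ʳ; ↑ˡ-injective; ↑ʳ-injective; toℕ<n)
open import Data.Fin.Subset using (Subset; inside; outside; _∈_; _∉_; _⊆_; ⁅_⁆; _∪_; _-_; ⊥; ∣_∣; Nonempty)
open import Data.Fin.Subset.Properties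
  using (_∈?_; ∉⊥; ⊆-refl; x∈⁅x⁆; x∈⁅y⁆⇒x≡y; x∈p∪q⁺; x∈p∪q⁻; p─⊥≡p; p─q⊆p; x∈p∧x≢y⇒x∈p-y; x∈p⇒∣p-x∣<∣p∣)
open import Data.List using (List; []; _∷_; length)
open import Data.List.Relation.Unary.All as All using (All; []; _∷_)
open import Data.List.Relation.Unary.All.Properties using (All¬⇒¬Any)
open import Data.List.Relation.Unary.Any using (Any; here; there)
open import Data.List.Relation.Unary.Linked using (Linked; [-]; _∷_)
open import Data.List.Relation.Unary.Unique.Propositional using (Unique)
open import Data.List.Relation.Unary.AllPairs using ([]; _∷_)
open import Data.Vec using (_∷_; here; there)
open import Data.Product using (Σ; ∃; _×_; _,_; proj₁)
open import Data.Sum using (_⊎_; inj₁; inj₂; [_,_]′)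
open import Data.Empty using (⊥-elim)
open import Relation.Nullary using (¬_; yes; no; contradiction)
open import Relation.Binary.PropositionalEquality using (_≡_; _≢_; refl; sym; cong; subst; ≢-sym)

∣s∷p∣≤1+∣p∣ : ∀ {k} s (p : Subset k) → ∣ s ∷ p ∣ ≤ suc ∣ p ∣
∣s∷p∣≤1+∣p∣ inside  p = ≤-refl
∣s∷p∣≤1+∣p∣ outside p = n≤1+n ∣ p ∣

∣p∣≤1+∣p-x∣ : ∀ {k} (p : Subset k) x → ∣ p ∣ ≤ suc ∣ p - x ∣
∣p∣≤1+∣p-x∣ (s ∷ p)       fzero    =
  ≤-trans (∣s∷p∣≤1+∣p∣ s p) (s≤s (≤-reflexive (cong ∣_∣ (sym (p─⊥≡p p)))))
∣p∣≤1+∣p-x∣ (inside ∷ p)  (fsuc x) = s≤s (∣p∣≤1+∣p-x∣ p x)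
∣p∣≤1+∣p-x∣ (outside ∷ p) (fsuc x) = ∣p∣≤1+∣p-x∣ p x

x∉p-x : ∀ {k} (p : Subset k) x → x ∉ p - x
x∉p-x (_ ∷ p) fzero    ()
x∉p-x (_ ∷ p) (fsuc x) (there x∈p-x) = x∉p-x p x x∈p-x

0<∣p∣⇒Nonempty : ∀ {k} (p : Subset k) → 0 < ∣ p ∣ → Nonempty p
0<∣p∣⇒Nonempty (inside ∷ p)  _   = fzero , here
0<∣p∣⇒Nonempty (outside ∷ p) 0<∣p∣ with 0<∣p∣⇒Nonempty p 0<∣p∣
... | x , x∈p = fsuc x , there x∈p

∃-∈-avoiding : ∀ {k} (p : Subset k) xs → length xs < ∣ p ∣ → ∃ λ w → w ∈ p × All (w ≢_) xs
∃-∈-avoiding p []       0<∣p∣ with 0<∣p∣⇒Nonempty p 0<∣p∣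
... | w , w∈p = w , w∈p , []
∃-∈-avoiding p (x ∷ xs) xs<∣p∣ with ∃-∈-avoiding (p - x) xs (≤-pred (≤-trans xs<∣p∣ (∣p∣≤1+∣p-x∣ p x)))
... | w , w∈p-x , w∉xs = w , p─q⊆p p ⁅ x ⁆ w∈p-x , w≢x ∷ w∉xs
  where
  w≢x : w ≢ x
  w≢x refl = x∉p-x p x w∈p-x

∣p∣≤length : ∀ {k} (p : Subset k) xs → (∀ {w} → w ∈ p → Any (w ≡_) xs) → ∣ p ∣ ≤ length xs
∣p∣≤length p xs p⊆xs with ∣ p ∣ ≤? length xs
... | yes ∣p∣≤ = ∣p∣≤
... | no ∣p∣≰ with ∃-∈-avoiding p xs (≰⇒> ∣p∣≰)
...   | w , w∈p , w∉xs = contradiction (p⊆xs w∈p) (All¬⇒¬Any w∉xs)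

length≤∣p∣ : ∀ {k} (p : Subset k) {xs} → Unique xs → All (_∈ p) xs → length xs ≤ ∣ p ∣
length≤∣p∣ p []              []          = z≤n
length≤∣p∣ p {x ∷ xs} (x≢xs ∷ xs!) (x∈p ∷ xs⊆p) =
  ≤-trans (s≤s (length≤∣p∣ (p - x) xs! xs⊆p-x)) (x∈p⇒∣p-x∣<∣p∣ x∈p)
  where
  xs⊆p-x : All (_∈ p - x) xs
  xs⊆p-x = All.zipWith (λ (x≢y , y∈p) → x∈p∧x≢y⇒x∈p-y y∈p (≢-sym x≢y)) (x≢xs , xs⊆p)

fromList : ∀ {k} → List (Fin k) → Subset k
fromList []       = ⊥
fromList (x ∷ xs) = ⁅ x ⁆ ∪ fromList xs

∈-fromList⁺ : ∀ {k} {w : Fin k} xs → Any (w ≡_) xs → w ∈ fromList xs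
∈-fromList⁺ (x ∷ _)  (here refl)  = x∈p∪q⁺ (inj₁ (x∈⁅x⁆ x))
∈-fromList⁺ (_ ∷ xs) (there w∈xs) = x∈p∪q⁺ (inj₂ (∈-fromList⁺ xs w∈xs))

∈-fromList⁻ : ∀ {k} {w : Fin k} xs → w ∈ fromList xs → Any (w ≡_) xs
∈-fromList⁻ []       w∈⊥ = ⊥-elim (∉⊥ w∈⊥)
∈-fromList⁻ (x ∷ xs) w∈  with x∈p∪q⁻ ⁅ x ⁆ (fromList xs) w∈
... | inj₁ w∈⁅x⁆ = here (x∈⁅y⁆⇒x≡y x w∈⁅x⁆)
... | inj₂ w∈xs  = there (∈-fromList⁻ xs w∈xs)

module _ (G : Graph) where

  record Cherry (S : Subset (n G)) : Set where
    constructor cherry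
    field
      {end₁ end₂ centre} : Fin (n G)
      end₁∈S        : end₁ ∈ S
      end₂∈S        : end₂ ∈ S
      centre∈S      : centre ∈ S
      ends-distinct : end₁ ≢ end₂
      centre-end₁   : Adj G centre end₁
      centre-end₂   : Adj G centre end₂

  TriangleFree : Set
  TriangleFree = ∀ {u v w} → Adj G u v → Adj G v w → ¬ Adj G w u

  EdgesDominating : Set
  EdgesDominating = ∀ {u v} w → Adj G u v → Adj G u w ⊎ Adj G v w

  TwoNeighbours : Fin (n G) → Set
  TwoNeighbours v = Σ (Fin (n G)) λ x → Σ (Fin (n G)) λ y → x ≢ y × Adj G v x × Adj G v y

  adj⇒≢ : ∀ {u v} → Adj G u v → u ≢ v
  adj⇒≢ uv refl = Adj-irr G uv

  cherry⇒3≤∣S∣ : ∀ {S} → Cherry S → 3 ≤ ∣ S ∣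
  cherry⇒3≤∣S∣ {S} (cherry x∈S y∈S z∈S x≢y zx zy) =
    length≤∣p∣ S ((≢-sym (adj⇒≢ zx) ∷ x≢y ∷ []) ∷ (adj⇒≢ zy ∷ []) ∷ [] ∷ [])
                 (x∈S ∷ z∈S ∷ y∈S ∷ [])

  cherry-mono : ∀ {S T} → S ⊆ T → Cherry S → Cherry T
  cherry-mono S⊆T (cherry x∈S y∈S z∈S x≢y zx zy) = cherry (S⊆T x∈S) (S⊆T y∈S) (S⊆T z∈S) x≢y zx zy

  ∈⇒InHull : ∀ {S p} → p ∈ S → InHull G S p
  ∈⇒InHull p∈S T S⊆T _ = S⊆T p∈S

  convex⇒common-neighbour∈ : ∀ {T} → CycleConvex G T → (c : Cherry T) →
    ∀ {w} → Adj G w (Cherry.end₁ c) → Adj G w (Cherry.end₂ c) → w ∈ T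
  convex⇒common-neighbour∈ {T} convex (cherry {x} {y} {z} x∈T y∈T z∈T x≢y zx zy) {w} wx wy
    with w ∈? T
  ... | yes w∈T = w∈T
  ... | no  w∉T = ⊥-elim (convex w w∉T (x ∷ z ∷ y ∷ [] , s≤s (s≤s z≤n) , x∈T ∷ z∈T ∷ y∈T ∷ [] , unique , linked))
    where
    w≢z : w ≢ z
    w≢z refl = w∉T z∈T
    unique : Unique (w ∷ x ∷ z ∷ y ∷ [])
    unique = (adj⇒≢ wx ∷ w≢z ∷ adj⇒≢ wy ∷ []) ∷ (≢-sym (adj⇒≢ zx) ∷ x≢y ∷ []) ∷ (adj⇒≢ zy ∷ []) ∷ [] ∷ []
    linked : Linked (Adj G) (w ∷ x ∷ z ∷ y ∷ w ∷ [])
    linked = wx ∷ Adj-sym G zx ∷ zy ∷ Adj-sym G wy ∷ [-]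

  module _ (triangle-free : TriangleFree) where

    cycle⇒cherry : ∀ {S u} → CycleThrough G S u → Cherry S
    cycle⇒cherry (_ ∷ [] , s≤s () , _)
    cycle⇒cherry (v₁ ∷ v₂ ∷ [] , _ , _ , _ , uv₁ ∷ v₁v₂ ∷ v₂u ∷ [-]) = ⊥-elim (triangle-free uv₁ v₁v₂ v₂u)
    cycle⇒cherry (v₁ ∷ v₂ ∷ v₃ ∷ _ , _ , v₁∈S ∷ v₂∈S ∷ v₃∈S ∷ _ , _ ∷ ((_ ∷ v₁≢v₃ ∷ _) ∷ _) , _ ∷ v₁v₂ ∷ v₂v₃ ∷ _) =
      cherry v₁∈S v₃∈S v₂∈S v₁≢v₃ (Adj-sym G v₁v₂) v₂v₃

    cherry-free⇒convex : ∀ {S} → ¬ Cherry S → CycleConvex G S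
    cherry-free⇒convex no-cherry u _ cycle = no-cherry (cycle⇒cherry cycle)

    cherry-free⇒InHull⇒∈ : ∀ {S p} → ¬ Cherry S → InHull G S p → p ∈ S
    cherry-free⇒InHull⇒∈ no-cherry p∈⟨S⟩ = p∈⟨S⟩ _ ⊆-refl (cherry-free⇒convex no-cherry)

    neighbour-of-end∉cherry : ∀ {x y z p} → Adj G z x → Adj G z y → Adj G x p → p ≢ z →
      All (p ≢_) (x ∷ y ∷ z ∷ [])
    neighbour-of-end∉cherry {y = y} {p = p} zx zy xp p≢z = ≢-sym (adj⇒≢ xp) ∷ p≢y ∷ p≢z ∷ []
      where
      p≢y : p ≢ y
      p≢y refl = triangle-free zx xp (Adj-sym G zy)

    module _ (dominating : EdgesDominating) (two-neighbours : ∀ v → TwoNeighbours v) where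

      convex∧cherry⇒full : ∀ {T} → CycleConvex G T → Cherry T → ∀ w → w ∈ T
      convex∧cherry⇒full {T} convex c@(cherry {x} {_} {z} x∈T _ _ _ zx zy) = full
        where
        neighbour-of-z⊎∈ : ∀ w → Adj G z w ⊎ w ∈ T
        neighbour-of-z⊎∈ w with dominating w zx | dominating w zy
        ... | inj₁ zw | _      = inj₁ zw
        ... | _       | inj₁ zw = inj₁ zw
        ... | inj₂ xw | inj₂ yw = inj₂ (convex⇒common-neighbour∈ convex c (Adj-sym G xw) (Adj-sym G yw))

        neighbour-of-x∈ : ∀ {v} → Adj G x v → v ∈ T
        neighbour-of-x∈ {v} xv with neighbour-of-z⊎∈ v
        ... | inj₁ zv  = ⊥-elim (triangle-free zx xv (Adj-sym G zv))
        ... | inj₂ v∈T = v∈T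

        full : ∀ w → w ∈ T
        full w with neighbour-of-z⊎∈ w | two-neighbours x
        ... | inj₂ w∈T | _ = w∈T
        ... | inj₁ zw  | v₁ , v₂ , v₁≢v₂ , xv₁ , xv₂ =
          convex⇒common-neighbour∈ convex
            (cherry (neighbour-of-x∈ xv₁) (neighbour-of-x∈ xv₂) x∈T v₁≢v₂ xv₁ xv₂)
            (neighbour-of-x⇒neighbour-of-w xv₁) (neighbour-of-x⇒neighbour-of-w xv₂)
          where
          neighbour-of-x⇒neighbour-of-w : ∀ {v} → Adj G x v → Adj G w v
          neighbour-of-x⇒neighbour-of-w xv with dominating w (Adj-sym G xv)
          ... | inj₁ vw = Adj-sym G vw
          ... | inj₂ xw = ⊥-elim (triangle-free zx xw (Adj-sym G zw))

      cherry⇒InHull : ∀ {S} → Cherry S → ∀ p → InHull G S p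
      cherry⇒InHull c p T S⊆T convex = convex∧cherry⇒full convex (cherry-mono S⊆T c) p

      cherry-minus-end₂ : ∀ {S} (c : Cherry S) → ∀ {w} → w ∈ S →
        All (w ≢_) (Cherry.end₁ c ∷ Cherry.end₂ c ∷ Cherry.centre c ∷ []) → Cherry (S - Cherry.end₂ c)
      cherry-minus-end₂ (cherry {x} {y} {z} x∈S _ z∈S x≢y zx zy) {w} w∈S (w≢x ∷ w≢y ∷ w≢z ∷ []) =
        [ (λ zw → cherry x∈S-y w∈S-y z∈S-y (≢-sym w≢x) zx zw)
        , (λ xw → cherry z∈S-y w∈S-y x∈S-y (≢-sym w≢z) (Adj-sym G zx) xw)
        ]′ (dominating w zx)
        where
        x∈S-y : x ∈ _ - y
        x∈S-y = x∈p∧x≢y⇒x∈p-y x∈S x≢y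
        w∈S-y : w ∈ _ - y
        w∈S-y = x∈p∧x≢y⇒x∈p-y w∈S w≢y
        z∈S-y : z ∈ _ - y
        z∈S-y = x∈p∧x≢y⇒x∈p-y z∈S (adj⇒≢ zy)

      ¬independent-of-size>3 : ∀ {S} → 3 < ∣ S ∣ → ¬ CaratheodoryIndependent G S
      ¬independent-of-size>3 {S} 3<∣S∣ (p , p∈⟨S⟩ , p∉⟨S-a⟩)
        with ∃-∈-avoiding S (p ∷ []) (≤-trans (s≤s (s≤s z≤n)) 3<∣S∣)
      ... | a , a∈S , a≢p ∷ [] = p∉⟨S-a⟩ a a∈S (∈⇒InHull (x∈p∧x≢y⇒x∈p-y p∈S (≢-sym a≢p)))
        where
        no-cherry : ¬ Cherry S
        no-cherry c with ∃-∈-avoiding S _ 3<∣S∣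
        ... | w , w∈S , w∉c = p∉⟨S-a⟩ _ (Cherry.end₂∈S c) (cherry⇒InHull (cherry-minus-end₂ c w∈S w∉c) p)
        p∈S : p ∈ S
        p∈S = cherry-free⇒InHull⇒∈ no-cherry p∈⟨S⟩

      independent⇒∣S∣≤3 : ∀ {S} → CaratheodoryIndependent G S → ∣ S ∣ ≤ 3
      independent⇒∣S∣≤3 {S} independent with ∣ S ∣ ≤? 3
      ... | yes ∣S∣≤3 = ∣S∣≤3
      ... | no  ∣S∣≰3 = ⊥-elim (¬independent-of-size>3 (≰⇒> ∣S∣≰3) independent)

      vertex-outside-cherry : ∀ {x y z} → Adj G z x → Adj G z y → ∃ λ p → All (p ≢_) (x ∷ y ∷ z ∷ [])
      vertex-outside-cherry {x} {y} {z} zx zy with two-neighbours x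
      ... | v₁ , v₂ , v₁≢v₂ , xv₁ , xv₂ with v₁ ≟ z
      ...   | yes refl = v₂ , neighbour-of-end∉cherry zx zy xv₂ (≢-sym v₁≢v₂)
      ...   | no  v₁≢z = v₁ , neighbour-of-end∉cherry zx zy xv₁ v₁≢z

      ∃-independent-of-size-3 : Fin (n G) → ∃ λ S → CaratheodoryIndependent G S × ∣ S ∣ ≡ 3
      ∃-independent-of-size-3 z with two-neighbours z
      ... | x , y , x≢y , zx , zy with vertex-outside-cherry zx zy
      ...   | p , p∉S = S , (p , cherry⇒InHull c p , p∉⟨S-a⟩) , ≤-antisym ∣S∣≤3 (cherry⇒3≤∣S∣ c)
        where
        xs : List (Fin (n G))
        xs = x ∷ y ∷ z ∷ []
        S : Subset (n G)
        S = fromList xs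
        c : Cherry S
        c = cherry (∈-fromList⁺ xs (here refl)) (∈-fromList⁺ xs (there (here refl)))
                   (∈-fromList⁺ xs (there (there (here refl)))) x≢y zx zy
        ∣S∣≤3 : ∣ S ∣ ≤ 3
        ∣S∣≤3 = ∣p∣≤length S xs (∈-fromList⁻ xs)

        p∉⟨S-a⟩ : ∀ a → a ∈ S → ¬ InHull G (S - a) p
        p∉⟨S-a⟩ a a∈S p∈⟨S-a⟩ =
          All¬⇒¬Any p∉S (∈-fromList⁻ xs (p─q⊆p S ⁅ a ⁆ (cherry-free⇒InHull⇒∈ no-cherry p∈⟨S-a⟩)))
          where
          no-cherry : ¬ Cherry (S - a)
          no-cherry c′ = <⇒≱ (<-≤-trans (x∈p⇒∣p-x∣<∣p∣ a∈S) ∣S∣≤3) (cherry⇒3≤∣S∣ c′)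

      car≡3 : Fin (n G) → CaratheodoryNumber G 3
      car≡3 v = ∃-independent-of-size-3 v , λ _ → independent⇒∣S∣≤3

two-distinct : ∀ {k} → 2 ≤ k → Σ (Fin k) λ i → Σ (Fin k) λ j → i ≢ j
two-distinct (s≤s (s≤s _)) = fzero , fsuc fzero , λ ()

module _ (a b : ℕ) where

  toℕ-↑ˡ< : ∀ (i : Fin a) → toℕ (i ↑ˡ b) < a
  toℕ-↑ˡ< i = subst (_< a) (sym (toℕ-↑ˡ i b)) (toℕ<n i)

  ≤toℕ-↑ʳ : ∀ (j : Fin b) → a ≤ toℕ (a ↑ʳ j)
  ≤toℕ-↑ʳ j = subst (a ≤_) (sym (toℕ-↑ʳ a j)) (m≤m+n a (toℕ j))

  left-adj⇒right : ∀ {u v} → toℕ u < a → KAdj a b u v → a ≤ toℕ v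
  left-adj⇒right _   (inj₁ (_ , a≤v)) = a≤v
  left-adj⇒right u<a (inj₂ (a≤u , _)) = ⊥-elim (<⇒≱ u<a a≤u)

  right-adj⇒left : ∀ {u v} → a ≤ toℕ u → KAdj a b u v → toℕ v < a
  right-adj⇒left a≤u (inj₁ (u<a , _)) = ⊥-elim (<⇒≱ u<a a≤u)
  right-adj⇒left _   (inj₂ (_ , v<a)) = v<a

  K-triangle-free : TriangleFree (K a b)
  K-triangle-free (inj₁ (u<a , a≤v)) vw wu = <⇒≱ u<a (left-adj⇒right (right-adj⇒left a≤v vw) wu)
  K-triangle-free (inj₂ (a≤u , v<a)) vw wu = <⇒≱ (right-adj⇒left (left-adj⇒right v<a vw) wu) a≤u

  K-edges-dominating : EdgesDominating (K a b)
  K-edges-dominating w uv with toℕ w <? a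
  K-edges-dominating w (inj₁ (u<a , a≤v)) | yes w<a = inj₂ (inj₂ (a≤v , w<a))
  K-edges-dominating w (inj₂ (a≤u , v<a)) | yes w<a = inj₁ (inj₂ (a≤u , w<a))
  K-edges-dominating w (inj₁ (u<a , a≤v)) | no  w≮a = inj₁ (inj₁ (u<a , ≮⇒≥ w≮a))
  K-edges-dominating w (inj₂ (a≤u , v<a)) | no  w≮a = inj₂ (inj₁ (v<a , ≮⇒≥ w≮a))

  K-two-neighbours : 2 ≤ a → 2 ≤ b → ∀ v → TwoNeighbours (K a b) v
  K-two-neighbours 2≤a 2≤b v with toℕ v <? a | two-distinct 2≤a | two-distinct 2≤b
  ... | yes v<a | _ | j , j′ , j≢j′ =
    a ↑ʳ j , a ↑ʳ j′ , (λ e → j≢j′ (↑ʳ-injective a j j′ e)) , inj₁ (v<a , ≤toℕ-↑ʳ j) , inj₁ (v<a , ≤toℕ-↑ʳ j′)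
  ... | no  v≮a | i , i′ , i≢i′ | _ =
    i ↑ˡ b , i′ ↑ˡ b , (λ e → i≢i′ (↑ˡ-injective b i i′ e)) , inj₂ (≮⇒≥ v≮a , toℕ-↑ˡ< i) , inj₂ (≮⇒≥ v≮a , toℕ-↑ˡ< i′)

corollary4p4 : ∀ m n → 2 ≤ m → 2 ≤ n → CaratheodoryNumber (K m n) 3
corollary4p4 m n 2≤m 2≤n =
  car≡3 (K m n) (K-triangle-free m n) (K-edges-dominating m n) (K-two-neighbours m n 2≤m 2≤n)
    (proj₁ (two-distinct 2≤m) ↑ˡ n)
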